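{- Let $n\ge0$, $k\ge1$ and $m\ge3$ be integers. The area of the $m$-sided polygon with vertices, in order, $V_i=(P_{n+2ik},P_{n+(2i+1)k})$ for $i=0,1,\dots,m-1$ equals $$\frac12\left|(m-1)P_kP_{2k}-P_kP_{(2m-2)k}\right|.$$ The area of the $m$-sided polygon with vertices, in order, $W_i=(Q_{n+2ik},Q_{n+(2i+1)k})$ for $i=0,1,\dots,m-1$ equals $$4\left|(m-1)P_kP_{2k}-P_kP_{(2m-2)k}\right|.$$
   Context: $P_n$ denotes the Pell numbers ($P_0=0$, $P_1=1$, $P_{n+1}=2P_n+P_{n-1}$) and $Q_n$ the Pell–Lucas numbers ($Q_0=2$, $Q_1=2$, $Q_{n+1}=2Q_n+Q_{n-1}$). The area of a polygon with vertices $(x_1,y_1),\dots,(x_m,y_m)$ taken in this order is given by the shoelace formula $\frac12\left|\sum_{i=1}^{m}(x_iy_{i+1}-x_{i+1}y_i)\right|$, indices taken mod $m$. -}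

module Defs where

open import Data.Nat using (ℕ; zero; suc)
open import Data.Integer using (ℤ; +_; _+_; _-_; _*_; ∣_∣)
open import Data.List using (List; []; _∷_; map; upTo)
open import Data.Rational using (ℚ; _/_)

P : ℕ → ℤ
P zero = + 0
P (suc zero) = + 1
P (suc (suc n)) = + 2 * P (suc n) + P n

Q : ℕ → ℤ
Q zero = + 2
Q (suc zero) = + 2
Q (suc (suc n)) = + 2 * Q (suc n) + Q n

open import Data.Product using (_×_; _,_)

cross : ℤ × ℤ → ℤ × ℤ → ℤ
cross (x₁ , y₁) (x₂ , y₂) = x₁ * y₂ - x₂ * y₁

shoelaceAux : ℤ × ℤ → List (ℤ × ℤ) → ℤ
shoelaceAux first [] = + 0
shoelaceAux first (v ∷ []) = cross v first
shoelaceAux first (v ∷ w ∷ vs) = cross v w + shoelaceAux first (w ∷ vs)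

shoelaceSum : List (ℤ × ℤ) → ℤ
shoelaceSum [] = + 0
shoelaceSum (v ∷ vs) = shoelaceAux v (v ∷ vs)

area : List (ℤ × ℤ) → ℚ
area vs = (+ ∣ shoelaceSum vs ∣) / 2

vertices : ℕ → (ℕ → ℤ × ℤ) → List (ℤ × ℤ)
vertices m f = map f (upTo m)

-- Every sequence G with G (n + 2) = 2 G (n + 1) + G n satisfies d'Ocagne's identity
-- G a G (a + j + k) − G (a + j) G (a + k) = P j P k (G a G (a + 2) − G (a + 1)²), and the
-- Cassini term G a G (a + 2) − G (a + 1)² only changes sign from a to a + 1. Hence the cross
-- products of consecutive vertices V i, V (i + 1) all equal P (2k) P k times one Cassini term,
-- the closing cross product V (m − 1), V 0 is − P k P ((2m − 2)k) times the same term, and the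
-- area is the absolute value of that Cassini term, 1 for P and 8 for Q, times the claimed bracket.
module Submission where

open import Defs
open import Data.Nat using (ℕ; zero; suc; _≥_; _∸_)
open import Data.Integer using (ℤ; +_; _-_; ∣_∣; -_; _+_; _*_)
open import Data.Product using (_×_; _,_)
open import Data.List using (applyUpTo)
open import Data.List.Properties using (map-upTo)
open import Data.Rational using (_/_)
open import Data.Rational.Properties using (fromℚᵘ-cong)
open import Data.Rational.Unnormalised using (mkℚᵘ; *≡*)
open import Function using (_∘_)
open import Relation.Binary.PropositionalEquality
import Data.Nat as N
import Data.Nat.Properties as NP
import Data.Integer.Properties as ZP
open import Data.Integer.Tactic.RingSolver using (solve-∀)
import Data.Nat.Tactic.RingSolver as NS

PellRecurrent : (ℕ → ℤ) → Set
PellRecurrent G = ∀ n → G (suc (suc n)) ≡ + 2 * G (suc n) + G n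

P-pellRecurrent : PellRecurrent P
P-pellRecurrent _ = refl

Q-pellRecurrent : PellRecurrent Q
Q-pellRecurrent _ = refl

casoratian : (ℕ → ℤ) → (ℕ → ℤ) → ℕ → ℤ
casoratian x y n = x n * y (suc n) - x (suc n) * y n

casoratian-suc : ∀ x y → PellRecurrent x → PellRecurrent y →
                 ∀ n → casoratian x y (suc n) ≡ - casoratian x y n
casoratian-suc x y rx ry n rewrite rx n | ry n =
  step (x n) (x (suc n)) (y n) (y (suc n))
  where
  step : ∀ x₀ x₁ y₀ y₁ → x₁ * (+ 2 * y₁ + y₀) - (+ 2 * x₁ + x₀) * y₁ ≡ - (x₀ * y₁ - x₁ * y₀)
  step = solve-∀

pellRecurrent-+ : ∀ G → PellRecurrent G →
                  ∀ j n → G (n N.+ suc j) ≡ P (suc j) * G (suc n) + P j * G n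
pellRecurrent-+ G rG zero n = trans (cong G (NP.+-comm n 1)) (base (G (suc n)) (G n))
  where
  base : ∀ a b → a ≡ + 1 * a + + 0 * b
  base = solve-∀
pellRecurrent-+ G rG (suc j) n = begin
  G (n N.+ suc (suc j))                                  ≡⟨ cong G (NP.+-suc n (suc j)) ⟩
  G (suc n N.+ suc j)                                    ≡⟨ pellRecurrent-+ G rG j (suc n) ⟩
  P (suc j) * G (suc (suc n)) + P j * G (suc n)          ≡⟨ cong (λ t → P (suc j) * t + P j * G (suc n)) (rG n) ⟩
  P (suc j) * (+ 2 * G (suc n) + G n) + P j * G (suc n)  ≡⟨ regroup (P (suc j)) (P j) (G (suc n)) (G n) ⟩
  P (suc (suc j)) * G (suc n) + P (suc j) * G n          ∎
  where
  open ≡-Reasoning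
  regroup : ∀ p₁ p₀ a b → p₁ * (+ 2 * a + b) + p₀ * a ≡ (+ 2 * p₁ + p₀) * a + p₁ * b
  regroup = solve-∀

casoratian-+ : ∀ x y → PellRecurrent x → PellRecurrent y →
               ∀ j n → x n * y (n N.+ j) - x (n N.+ j) * y n ≡ P j * casoratian x y n
casoratian-+ x y rx ry zero n rewrite NP.+-identityʳ n =
  cancel (x n) (y n) (casoratian x y n)
  where
  cancel : ∀ a b w → a * b - a * b ≡ + 0 * w
  cancel = solve-∀
casoratian-+ x y rx ry (suc j) n
  rewrite pellRecurrent-+ x rx j n | pellRecurrent-+ y ry j n =
  collect (P (suc j)) (P j) (x n) (x (suc n)) (y n) (y (suc n))
  where
  collect : ∀ p₁ p₀ x₀ x₁ y₀ y₁ →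
            x₀ * (p₁ * y₁ + p₀ * y₀) - (p₁ * x₁ + p₀ * x₀) * y₀ ≡ p₁ * (x₀ * y₁ - x₁ * y₀)
  collect = solve-∀

cassini : (ℕ → ℤ) → ℕ → ℤ
cassini G = casoratian G (G ∘ suc)

cassini-suc : ∀ G → PellRecurrent G → ∀ a → cassini G (suc a) ≡ - cassini G a
cassini-suc G rG = casoratian-suc G (G ∘ suc) rG (rG ∘ suc)

cassini-+2* : ∀ G → PellRecurrent G → ∀ a t → cassini G (a N.+ 2 N.* t) ≡ cassini G a
cassini-+2* G rG a zero = cong (cassini G) (NP.+-identityʳ a)
cassini-+2* G rG a (suc t) = begin
  cassini G (a N.+ 2 N.* suc t)            ≡⟨ cong (cassini G) (two-more a t) ⟩
  cassini G (suc (suc (a N.+ 2 N.* t)))    ≡⟨ cassini-suc G rG _ ⟩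
  - cassini G (suc (a N.+ 2 N.* t))        ≡⟨ cong -_ (cassini-suc G rG _) ⟩
  - - cassini G (a N.+ 2 N.* t)            ≡⟨ ZP.neg-involutive _ ⟩
  cassini G (a N.+ 2 N.* t)                ≡⟨ cassini-+2* G rG a t ⟩
  cassini G a                              ∎
  where
  open ≡-Reasoning
  two-more : ∀ a t → a N.+ 2 N.* suc t ≡ suc (suc (a N.+ 2 N.* t))
  two-more = NS.solve-∀

∣cassini∣-constant : ∀ G → PellRecurrent G → ∀ a → ∣ cassini G a ∣ ≡ ∣ cassini G 0 ∣
∣cassini∣-constant G rG zero = refl
∣cassini∣-constant G rG (suc a) = begin
  ∣ cassini G (suc a) ∣  ≡⟨ cong ∣_∣ (cassini-suc G rG a) ⟩
  ∣ - cassini G a ∣      ≡⟨ ZP.∣-i∣≡∣i∣ (cassini G a) ⟩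
  ∣ cassini G a ∣        ≡⟨ ∣cassini∣-constant G rG a ⟩
  ∣ cassini G 0 ∣        ∎
  where open ≡-Reasoning

dOcagne : ∀ G → PellRecurrent G → ∀ a j k →
          G a * G (a N.+ j N.+ k) - G (a N.+ j) * G (a N.+ k) ≡ P j * P k * cassini G a
dOcagne G rG a j k = begin
  G a * G (a N.+ j N.+ k) - G (a N.+ j) * G (a N.+ k)
    ≡⟨ casoratian-+ G (λ t → G (t N.+ k)) rG (λ t → rG (t N.+ k)) j a ⟩
  P j * (G a * G (suc a N.+ k) - G (suc a) * G (a N.+ k))
    ≡⟨ cong (λ u → P j * (G a * G (suc a N.+ k) - u)) (ZP.*-comm (G (suc a)) (G (a N.+ k))) ⟩
  P j * (G a * G (suc (a N.+ k)) - G (a N.+ k) * G (suc a))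
    ≡⟨ cong (P j *_) (casoratian-+ G (G ∘ suc) rG (rG ∘ suc) k a) ⟩
  P j * (P k * cassini G a)
    ≡⟨ ZP.*-assoc (P j) (P k) (cassini G a) ⟨
  P j * P k * cassini G a
    ∎
  where open ≡-Reasoning

dOcagne-at : ∀ G → PellRecurrent G → ∀ a j k {a′ b c d} →
             a′ ≡ a → b ≡ a N.+ j → c ≡ a N.+ k → d ≡ a N.+ j N.+ k →
             G a′ * G d - G b * G c ≡ P j * P k * cassini G a
dOcagne-at G rG a j k refl refl refl refl = dOcagne G rG a j k

cross-antisym : ∀ u v → cross u v ≡ - cross v u
cross-antisym (x₁ , y₁) (x₂ , y₂) = swap x₁ y₁ x₂ y₂
  where
  swap : ∀ x₁ y₁ x₂ y₂ → x₁ * y₂ - x₂ * y₁ ≡ - (x₂ * y₁ - x₁ * y₂)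
  swap = solve-∀

shoelaceAux-uniform : ∀ (g : ℕ → ℤ × ℤ) c → (∀ i → cross (g i) (g (suc i)) ≡ c) →
                      ∀ v l → shoelaceAux v (applyUpTo g (suc l)) ≡ + l * c + cross (g l) v
shoelaceAux-uniform g c g-cross v zero = begin
  cross (g 0) v             ≡⟨ ZP.+-identityˡ _ ⟨
  + 0 + cross (g 0) v       ≡⟨ cong (_+ cross (g 0) v) (ZP.*-zeroˡ c) ⟨
  + 0 * c + cross (g 0) v   ∎
  where open ≡-Reasoning
shoelaceAux-uniform g c g-cross v (suc l) = begin
  cross (g 0) (g 1) + shoelaceAux v (applyUpTo (g ∘ suc) (suc l))
    ≡⟨ cong₂ _+_ (g-cross 0) (shoelaceAux-uniform (g ∘ suc) c (g-cross ∘ suc) v l) ⟩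
  c + (+ l * c + cross (g (suc l)) v)
    ≡⟨ one-more c (+ l) (cross (g (suc l)) v) ⟩
  + suc l * c + cross (g (suc l)) v
    ∎
  where
  open ≡-Reasoning
  one-more : ∀ c l x → c + (l * c + x) ≡ (+ 1 + l) * c + x
  one-more = solve-∀

shoelaceSum-uniform : ∀ (g : ℕ → ℤ × ℤ) c → (∀ i → cross (g i) (g (suc i)) ≡ c) →
                      ∀ r → shoelaceSum (vertices (suc r) g) ≡ + r * c + cross (g r) (g 0)
shoelaceSum-uniform g c g-cross r = begin
  shoelaceAux (g 0) (vertices (suc r) g)     ≡⟨ cong (shoelaceAux (g 0)) (map-upTo g (suc r)) ⟩
  shoelaceAux (g 0) (applyUpTo g (suc r))    ≡⟨ shoelaceAux-uniform g c g-cross (g 0) r ⟩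
  + r * c + cross (g r) (g 0)                ∎
  where open ≡-Reasoning

pairedVertex : (ℕ → ℤ) → ℕ → ℕ → ℕ → ℤ × ℤ
pairedVertex G n k i = G (n N.+ 2 N.* i N.* k) , G (n N.+ (2 N.* i N.+ 1) N.* k)

shoelaceSum-pairedVertex : ∀ G → PellRecurrent G → ∀ n k r →
  shoelaceSum (vertices (suc r) (pairedVertex G n k))
    ≡ cassini G n * (+ r * P k * P (2 N.* k) - P k * P (2 N.* r N.* k))
shoelaceSum-pairedVertex G rG n k r = begin
  shoelaceSum (vertices (suc r) V)
    ≡⟨ shoelaceSum-uniform V (P (2 N.* k) * P k * cassini G n) consecutive r ⟩
  + r * (P (2 N.* k) * P k * cassini G n) + cross (V r) (V 0)
    ≡⟨ cong (_+_ (+ r * (P (2 N.* k) * P k * cassini G n))) closing ⟩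
  + r * (P (2 N.* k) * P k * cassini G n) + - (P (2 N.* r N.* k) * P k * cassini G n)
    ≡⟨ factor (+ r) (P k) (P (2 N.* k)) (P (2 N.* r N.* k)) (cassini G n) ⟩
  cassini G n * (+ r * P k * P (2 N.* k) - P k * P (2 N.* r N.* k))
    ∎
  where
  open ≡-Reasoning
  V = pairedVertex G n k

  consecutive : ∀ i → cross (V i) (V (suc i)) ≡ P (2 N.* k) * P k * cassini G n
  consecutive i = begin
    cross (V i) (V (suc i))
      ≡⟨ dOcagne-at G rG (n N.+ 2 N.* (i N.* k)) (2 N.* k) k
           (e₀ n i k) (e₁ n i k) (e₂ n i k) (e₃ n i k) ⟩
    P (2 N.* k) * P k * cassini G (n N.+ 2 N.* (i N.* k))
      ≡⟨ cong (P (2 N.* k) * P k *_) (cassini-+2* G rG n (i N.* k)) ⟩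
    P (2 N.* k) * P k * cassini G n
      ∎
    where
    e₀ : ∀ n i k → n N.+ 2 N.* i N.* k ≡ n N.+ 2 N.* (i N.* k)
    e₀ = NS.solve-∀
    e₁ : ∀ n i k → n N.+ 2 N.* suc i N.* k ≡ n N.+ 2 N.* (i N.* k) N.+ 2 N.* k
    e₁ = NS.solve-∀
    e₂ : ∀ n i k → n N.+ (2 N.* i N.+ 1) N.* k ≡ n N.+ 2 N.* (i N.* k) N.+ k
    e₂ = NS.solve-∀
    e₃ : ∀ n i k → n N.+ (2 N.* suc i N.+ 1) N.* k ≡ n N.+ 2 N.* (i N.* k) N.+ 2 N.* k N.+ k
    e₃ = NS.solve-∀

  closing : cross (V r) (V 0) ≡ - (P (2 N.* r N.* k) * P k * cassini G n)
  closing = begin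
    cross (V r) (V 0)
      ≡⟨ cross-antisym (V r) (V 0) ⟩
    - cross (V 0) (V r)
      ≡⟨ cong -_ (dOcagne-at G rG n (2 N.* r N.* k) k (NP.+-identityʳ n) refl (f₁ n k) (f₂ n r k)) ⟩
    - (P (2 N.* r N.* k) * P k * cassini G n) ∎
    where
    f₁ : ∀ n k → n N.+ (2 N.* 0 N.+ 1) N.* k ≡ n N.+ k
    f₁ = NS.solve-∀
    f₂ : ∀ n r k → n N.+ (2 N.* r N.+ 1) N.* k ≡ n N.+ 2 N.* r N.* k N.+ k
    f₂ = NS.solve-∀

  factor : ∀ r p₁ p₂ p₃ c → r * (p₂ * p₁ * c) + - (p₃ * p₁ * c) ≡ c * (r * p₁ * p₂ - p₁ * p₃)
  factor = solve-∀

∣shoelaceSum∣-pairedVertex : ∀ G → PellRecurrent G → ∀ n k r →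
  ∣ shoelaceSum (vertices (suc r) (pairedVertex G n k)) ∣
    ≡ ∣ cassini G 0 ∣ N.* ∣ + r * P k * P (2 N.* k) - P k * P ((2 N.* suc r ∸ 2) N.* k) ∣
∣shoelaceSum∣-pairedVertex G rG n k r = begin
  ∣ shoelaceSum (vertices (suc r) (pairedVertex G n k)) ∣
    ≡⟨ cong ∣_∣ (shoelaceSum-pairedVertex G rG n k r) ⟩
  ∣ cassini G n * bracket (2 N.* r N.* k) ∣
    ≡⟨ ZP.abs-* (cassini G n) (bracket (2 N.* r N.* k)) ⟩
  ∣ cassini G n ∣ N.* ∣ bracket (2 N.* r N.* k) ∣
    ≡⟨ cong₂ (λ c i → c N.* ∣ bracket i ∣) (∣cassini∣-constant G rG n) (last-index r k) ⟩
  ∣ cassini G 0 ∣ N.* ∣ bracket ((2 N.* suc r ∸ 2) N.* k) ∣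
    ∎
  where
  open ≡-Reasoning
  bracket : ℕ → ℤ
  bracket i = + r * P k * P (2 N.* k) - P k * P i
  last-index : ∀ r k → 2 N.* r N.* k ≡ (2 N.* suc r ∸ 2) N.* k
  last-index r k =
    cong (N._* k) (sym (trans (cong (_∸ 2) (NP.*-suc 2 r)) (NP.m+n∸m≡n 2 (2 N.* r))))

*-cancel-/ : ∀ d t → (+ (suc d N.* t)) / suc d ≡ (+ t) / 1
*-cancel-/ d t = fromℚᵘ-cong {mkℚᵘ (+ (suc d N.* t)) d} {mkℚᵘ (+ t) 0} (*≡* (begin
  + (suc d N.* t) * + 1  ≡⟨ ZP.*-identityʳ _ ⟩
  + (suc d N.* t)        ≡⟨ cong +_ (NP.*-comm (suc d) t) ⟩
  + (t N.* suc d)        ≡⟨ ZP.pos-* t (suc d) ⟩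
  + t * + suc d          ∎))
  where open ≡-Reasoning

-- The identity holds for all k and all m ≥ 1; the hypotheses are only used to exclude m = 0.
theorem3p2 : (n k m : ℕ) → k ≥ 1 → m ≥ 3 →
    (area (vertices m (λ i → P (n N.+ 2 N.* i N.* k) , P (n N.+ (2 N.* i N.+ 1) N.* k)))
      ≡ (+ ∣ (+ (m ∸ 1)) * P k * P (2 N.* k) - P k * P ((2 N.* m ∸ 2) N.* k) ∣) / 2)
    × (area (vertices m (λ i → Q (n N.+ 2 N.* i N.* k) , Q (n N.+ (2 N.* i N.+ 1) N.* k)))
      ≡ (+ (4 N.* ∣ (+ (m ∸ 1)) * P k * P (2 N.* k) - P k * P ((2 N.* m ∸ 2) N.* k) ∣)) / 1)
theorem3p2 n k zero _ ()
theorem3p2 n k (suc r) _ _ =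
    cong (λ s → + s / 2) (trans (∣shoelaceSum∣-pairedVertex P P-pellRecurrent n k r) (NP.*-identityˡ _))
  , (begin
      + ∣ shoelaceSum (vertices (suc r) (pairedVertex Q n k)) ∣ / 2
        ≡⟨ cong (λ s → + s / 2) (∣shoelaceSum∣-pairedVertex Q Q-pellRecurrent n k r) ⟩
      + (8 N.* bracket) / 2
        ≡⟨ cong (λ s → + s / 2) (NP.*-assoc 2 4 bracket) ⟩
      + (2 N.* (4 N.* bracket)) / 2
        ≡⟨ *-cancel-/ 1 (4 N.* bracket) ⟩
      + (4 N.* bracket) / 1
        ∎)
  where
  open ≡-Reasoning
  bracket : ℕ
  bracket = ∣ + r * P k * P (2 N.* k) - P k * P ((2 N.* suc r ∸ 2) N.* k) ∣
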